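{- Let $\Theta$ be an open saturated branch of a tableau of $\mathbf{TAB}_{\mathbf{IB}}$ with root formula $@_{i_0}\varphi_0$, let $\mathcal{M}^\Theta$ be its model, $W^\Theta_r$ the set of reflexive worlds of $\mathcal{M}^\Theta$, and $\mathcal{M}^\Theta_B$ the bulldozed model of $\mathcal{M}^\Theta$. For every nominal $i\in W^\Theta_r$ and every formula $\varphi$ such that $@_i\varphi$ is a quasi-subformula of $@_{i_0}\varphi_0$, we have $\mathcal{M}^\Theta_B,(i,0)\models\varphi$ if and only if $\mathcal{M}^\Theta_B,(i,1)\models\varphi$.
   Context: Hybrid language: fix disjoint countably infinite sets $\mathbf{Prop}$ (propositional variables) and $\mathbf{Nom}$ (nominals). Formulas: $\varphi ::= p \mid i \mid \neg\varphi \mid \varphi\land\varphi \mid \diamondsuit\varphi \mid @_i\varphi$ with $p\in\mathbf{Prop}$, $i\in\mathbf{Nom}$; $\square\varphi$ abbreviates $\neg\diamondsuit\neg\varphi$. A model is $(W,R,V)$ with $W\neq\emptyset$, $R\subseteq W\times W$, $V:\mathbf{Prop}\cup\mathbf{Nom}\to\mathcal{P}(W)$ with $V(i)=\{i^V\}$ a singleton for each nominal $i$. Satisfaction: $w\models p$ iff $w\in V(p)$; $w\models i$ iff $w=i^V$; Boolean clauses as usual; $w\models\diamondsuit\varphi$ iff some $v$ with $wRv$ has $v\models\varphi$; $w\models @_i\varphi$ iff $i^V\models\varphi$. Tableaux of $\mathbf{TAB}_{\mathbf{IB}}$: a tableau is a well-founded tree of formulas of the form $@_i\varphi$, started from a root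 formula $@_i\varphi$ where $i$ does not occur in $\varphi$. Each branch (maximal path) is extended by applying the rules below as often as possible, except that nothing more is added to a branch once it is closed, or once every formula that any rule could generate already occurs on it. A branch $\Theta$ is closed if $@_i\varphi, @_i\neg\varphi\in\Theta$ for some $i,\varphi$, open otherwise, and saturated if every formula that any rule could generate from it already occurs in $\Theta$. Rules (premises already on the branch, conclusions added to it): [$\neg\neg$] from $@_i\neg\neg\varphi$ add $@_i\varphi$; [$\land$] from $@_i(\varphi\land\psi)$ add $@_i\varphi$ and $@_i\psi$; [$\neg\land$] from $@_i\neg(\varphi\land\psi)$ split the branch into one branch with $@_i\neg\varphi$ and one with $@_i\neg\psi$; [$\diamondsuit$] from $@_i\diamondsuit\varphi$ add $@_i\diamondsuit j$ and $@_j\varphi$, where $j$ is a nominal not yet occurring on the branch, the rule is applied at most once per formula, the premise is not an accessibility formula, and (restriction $\mathcal{D}$) $i$ is a quasi-urfather on the branch; [$\neg\diamondsuit$] from $@_i\neg\diamondsuit\varphi$ and $@_i\diamondsuit j$ add $@_j\neg\varphi$; [$@$] from $@_i@_j\varphi$ add $@_j\varphi$; [$\neg@$] from $@_i\neg@_j\varphi$ add $@_j\neg\varphi$; [$\mathit{Id}$] from $@_i\varphi$ and $@_i j$ add $@_j\varphi$, provided $@_i\varphi$ is not an accessibility formula; [$\mathit{Ref}$] add $@_i i$ for any nominal $i$ occurring on the branch; [$\square_{\mathit{sym}}$] from $@_i\square\varphi$ and $@_j\diamondsuit i$ add $@_j\varphi$; ($\mathcal{I}$) for every nominal $i$ occurring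 on the branch add $@_i\neg\diamondsuit i$. An accessibility formula is a formula $@_i\diamondsuit j$ added by [$\diamondsuit$] with $j$ new. Auxiliary notions for a branch $\Theta$: $@_i\varphi$ is a quasi-subformula of $@_j\psi$ if $\varphi$ is a subformula of $\psi$, or $\varphi=\neg\chi$ with $\chi$ a subformula of $\psi$. $T^\Theta(i)=\{\varphi \mid @_i\varphi\in\Theta$ and $@_i\varphi$ is a quasi-subformula of the root formula$\}$. Nominals $i,j$ are twins in $\Theta$ if $T^\Theta(i)=T^\Theta(j)$. $i\prec_\Theta j$ if $j$ was introduced by applying [$\diamondsuit$] to a formula $@_i\diamondsuit\varphi$; $\prec_\Theta^*$ is its reflexive transitive closure. A nominal $i$ is a quasi-urfather on $\Theta$ if there are no twins $j\neq k$ with $j\prec_\Theta^* i$ and $k\prec_\Theta^* i$. The identity urfather $v_\Theta(i)$ of a nominal $i$ occurring in $\Theta$ is the earliest introduced nominal $j$ on $\Theta$ that is a twin of $i$ and a quasi-urfather on $\Theta$, if such $j$ exists; $\mathrm{dom}(v_\Theta)$ is the set of nominals $i$ for which $v_\Theta(i)$ exists; $i$ is called an identity urfather if $v_\Theta(i)=i$. The model $\mathcal{M}^\Theta=(W^\Theta,R^\Theta,V^\Theta)$ of an open saturated branch $\Theta$ with root formula $@_{i_0}\varphi_0$: $W^\Theta$ is the set of identity urfathers on $\Theta$; $R^\Theta=\{(v_\Theta(i),v_\Theta(j)) \mid @_i\diamondsuit j\in\Theta,\ i,j\in\mathrm{dom}(v_\Theta)\}\cup\{(v_\Theta(j),v_\Theta(i))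 \mid @_i\diamondsuit j\in\Theta,\ i,j\in\mathrm{dom}(v_\Theta)\}$; $V^\Theta(p)=\{v_\Theta(i)\mid @_i p\in\Theta\}$ for $p\in\mathbf{Prop}$; for $i\in\mathbf{Nom}$, $V^\Theta(i)=\{v_\Theta(i)\}$ if $i\in\mathrm{dom}(v_\Theta)$ and $V^\Theta(i)=\{i_0\}$ otherwise. $W^\Theta_r=\{w\in W^\Theta\mid wR^\Theta w\}$. Bulldozed model: for a model $\mathcal{M}=(W,R,V)$, let $W_r=\{w\in W\mid wRw\}$, $W^-=W\setminus W_r$, and $W_B=W^-\cup\{(w,n)\mid w\in W_r,\ n\in\{0,1\}\}$. Define $\alpha:W_B\to W$ by $\alpha(w)=w$ for $w\in W^-$ and $\alpha((w,n))=w$. Put $wR_Bv$ iff one of: (1) $w\in W^-$ or $v\in W^-$, and $\alpha(w)R\alpha(v)$; (2) $w=(w',m)$, $v=(v',n)$, $w'\neq v'$ and $w'Rv'$; (3) $w\neq v$ and $\alpha(w)=\alpha(v)$. Put $w\in V_B(p)$ iff $\alpha(w)\in V(p)$ for $p\in\mathbf{Prop}$; for $i\in\mathbf{Nom}$, $V_B(i)=\{(i^V,0)\}$ if $i^V\in W_r$ and $V_B(i)=V(i)$ otherwise. $\mathcal{M}_B=(W_B,R_B,V_B)$. $\mathcal{M}^\Theta_B$ denotes the bulldozed model of $\mathcal{M}^\Theta$. -}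

module Defs where

open import Data.Nat using (ℕ; _<_)
open import Data.Fin using (Fin; zero; suc)
open import Data.List using (List; []; _∷_; _++_; concatMap)
open import Data.List.Membership.Propositional using (_∈_)
open import Data.Product using (Σ; _×_; _,_; proj₁; proj₂; ∃)
open import Data.Sum using (_⊎_; inj₁; inj₂)
open import Data.Empty using (⊥)
open import Relation.Nullary using (¬_)
open import Relation.Binary.PropositionalEquality using (_≡_; _≢_)
open import Relation.Binary.Construct.Closure.ReflexiveTransitive using (Star)

Nom : Set
Nom = ℕ

infixr 6 _∧_
data Form : Set where
  prop : ℕ → Form
  nom  : Nom → Form
  ~_   : Form → Form
  _∧_  : Form → Form → Form
  ◇_   : Form → Form
  at   : Nom → Form → Form

□_ : Form → Form
□ φ = ~ (◇ (~ φ))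

data Sub : Form → Form → Set where
  here  : ∀ {φ} → Sub φ φ
  neg   : ∀ {φ ψ} → Sub φ ψ → Sub φ (~ ψ)
  andl  : ∀ {φ ψ χ} → Sub φ ψ → Sub φ (ψ ∧ χ)
  andr  : ∀ {φ ψ χ} → Sub φ χ → Sub φ (ψ ∧ χ)
  dia   : ∀ {φ ψ} → Sub φ ψ → Sub φ (◇ ψ)
  atS   : ∀ {φ ψ i} → Sub φ ψ → Sub φ (at i ψ)

data OccF (i : Nom) : Form → Set where
  onom  : OccF i (nom i)
  oneg  : ∀ {φ} → OccF i φ → OccF i (~ φ)
  oandl : ∀ {φ ψ} → OccF i φ → OccF i (φ ∧ ψ)
  oandr : ∀ {φ ψ} → OccF i ψ → OccF i (φ ∧ ψ)
  odia  : ∀ {φ} → OccF i φ → OccF i (◇ φ)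
  oat1  : ∀ {φ} → OccF i (at i φ)
  oat2  : ∀ {j φ} → OccF i φ → OccF i (at j φ)

-- tableau formulas @_i φ, represented as pairs (i , φ)
LForm : Set
LForm = Nom × Form

OccL : Nom → LForm → Set
OccL i (k , ψ) = i ≡ k ⊎ OccF i ψ

-- @_i φ is a quasi-subformula of @_j ψ  (depends only on φ, ψ)
QSub : Form → Form → Set
QSub φ ψ = Sub φ ψ ⊎ Σ Form (λ χ → φ ≡ ~ χ × Sub χ ψ)

-- Branches, represented by their root formula and the history of rule
-- applications (newest first).

data Step : Set where
  add1 : LForm → Step
  add2 : LForm → LForm → Step
  dstep : Nom → Form → Nom → Step     -- [◇] on @_i ◇φ with new j

added : Step → List LForm
added (add1 x)      = x ∷ []
added (add2 x y)    = x ∷ y ∷ []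
added (dstep i φ j) = (i , ◇ nom j) ∷ (j , φ) ∷ []

module _ (r : LForm) where

  root-body : Form
  root-body = proj₂ r

  i₀ : Nom
  i₀ = proj₁ r

  InB : List Step → LForm → Set
  InB h x = x ≡ r ⊎ x ∈ concatMap added h

  OccB : List Step → Nom → Set
  OccB h i = Σ LForm (λ x → InB h x × OccL i x)

  Closed : List Step → Set
  Closed h = Σ Nom (λ i → Σ Form (λ φ → InB h (i , φ) × InB h (i , ~ φ)))

  Access : List Step → LForm → Set
  Access h (i , ψ) = Σ Form (λ φ → Σ Nom (λ k → dstep i φ k ∈ h × ψ ≡ ◇ nom k))

  Prec : List Step → Nom → Nom → Set
  Prec h i j = Σ Form (λ φ → dstep i φ j ∈ h)

  Prec* : List Step → Nom → Nom → Set
  Prec* h = Star (Prec h)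

  TIn : List Step → Nom → Form → Set
  TIn h i φ = InB h (i , φ) × QSub φ root-body

  Twins : List Step → Nom → Nom → Set
  Twins h i j = ∀ φ → (TIn h i φ → TIn h j φ) × (TIn h j φ → TIn h i φ)

  QU : List Step → Nom → Set
  QU h i = ¬ Σ Nom (λ j → Σ Nom (λ k →
             j ≢ k × Twins h j k × Prec* h j i × Prec* h k i))

  -- Non-root nominals are ordered
  -- by the stage where they first occur; root nominals come first, with
  -- i₀ first and the remaining root nominals ordered by index.
  Before : List Step → Nom → Nom → Set
  Before h j k =
      Σ (List Step) (λ pre → Σ (List Step) (λ h' →
         h ≡ pre ++ h' × OccB h' j × ¬ OccB h' k))
    ⊎ (j ≡ i₀ × k ≢ i₀ × OccL k r)
    ⊎ (OccL j r × OccL k r × j ≢ i₀ × k ≢ i₀ × j < k)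

  -- IsV h i j :  v_Θ(i) = j
  IsV : List Step → Nom → Nom → Set
  IsV h i j = OccB h i × OccB h j × Twins h i j × QU h j ×
              (∀ k → OccB h k → Twins h i k → QU h k → ¬ Before h k j)

  -- rule instances (all rules except the branching [¬∧])
  data Legal (h : List Step) : Step → Set where
    r¬¬  : ∀ {i φ} → InB h (i , ~ ~ φ) → Legal h (add1 (i , φ))
    r∧   : ∀ {i φ ψ} → InB h (i , φ ∧ ψ) → Legal h (add2 (i , φ) (i , ψ))
    r◇   : ∀ {i φ j} → InB h (i , ◇ φ) → ¬ OccB h j →
           ¬ Σ Nom (λ k → dstep i φ k ∈ h) →
           ¬ Access h (i , ◇ φ) → QU h i → Legal h (dstep i φ j)
    r¬◇  : ∀ {i φ j} → InB h (i , ~ ◇ φ) → InB h (i , ◇ nom j) →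
           Legal h (add1 (j , ~ φ))
    rAt  : ∀ {i j φ} → InB h (i , at j φ) → Legal h (add1 (j , φ))
    r¬At : ∀ {i j φ} → InB h (i , ~ at j φ) → Legal h (add1 (j , ~ φ))
    rId  : ∀ {i j φ} → InB h (i , φ) → InB h (i , nom j) →
           ¬ Access h (i , φ) → Legal h (add1 (j , φ))
    rRef : ∀ {i} → OccB h i → Legal h (add1 (i , nom i))
    r□s  : ∀ {i j φ} → InB h (i , □ φ) → InB h (j , ◇ nom i) →
           Legal h (add1 (j , φ))
    rI   : ∀ {i} → OccB h i → Legal h (add1 (i , ~ ◇ nom i))

  -- [¬∧], with the choice of the branch taken
  data Split (h : List Step) : Step → Set where
    left  : ∀ {i φ ψ} → InB h (i , ~ (φ ∧ ψ)) → Split h (add1 (i , ~ φ))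
    right : ∀ {i φ ψ} → InB h (i , ~ (φ ∧ ψ)) → Split h (add1 (i , ~ ψ))

  Present : List Step → Step → Set
  Present h (add1 x)      = InB h x
  Present h (add2 x y)    = InB h x × InB h y
  Present h (dstep _ _ _) = ⊥     -- [◇] always produces a new nominal

  Saturated : List Step → Set
  Saturated h =
    (∀ s → Legal h s → Present h s) ×
    (∀ i φ ψ → InB h (i , ~ (φ ∧ ψ)) → InB h (i , ~ φ) ⊎ InB h (i , ~ ψ))

  data Branch : List Step → Set where
    start : Branch []
    step  : ∀ {h s} → Branch h → ¬ Closed h → ¬ Saturated h →
            Legal h s ⊎ Split h s → Branch (s ∷ h)

-- Models, with worlds given as a domain predicate on a carrier.

record Model : Set₁ where
  field
    Carrier : Set
    Dom     : Carrier → Set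
    R       : Carrier → Carrier → Set
    Vp      : ℕ → Carrier → Set
    Vn      : Nom → Carrier → Set

open Model

Sat : (M : Model) → Carrier M → Form → Set
Sat M w (prop p) = Vp M p w
Sat M w (nom i)  = Vn M i w
Sat M w (~ φ)    = ¬ Sat M w φ
Sat M w (φ ∧ ψ)  = Sat M w φ × Sat M w ψ
Sat M w (◇ φ)    = Σ (Carrier M) (λ v → Dom M v × R M w v × Sat M v φ)
Sat M w (at i φ) = ∀ v → Dom M v → Vn M i v → Sat M v φ

-- The model M^Θ of a branch (worlds: identity urfathers).
BranchModel : LForm → List Step → Model
BranchModel r h = record
  { Carrier = Nom
  ; Dom     = λ i → IsV r h i i
  ; R       = λ w u → Σ Nom (λ i → Σ Nom (λ j → InB r h (i , ◇ nom j) ×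
                 ((IsV r h i w × IsV r h j u) ⊎ (IsV r h j w × IsV r h i u))))
  ; Vp      = λ p w → Σ Nom (λ i → InB r h (i , prop p) × IsV r h i w)
  ; Vn      = λ k w → IsV r h k w ⊎ ((¬ Σ Nom (IsV r h k)) × w ≡ i₀ r)
  }

-- Bulldozed model.  Carrier: inj₁ w for w ∈ W⁻, inj₂ (w , n) for (w,n).
module _ (M : Model) where

  α : Carrier M ⊎ (Carrier M × Fin 2) → Carrier M
  α (inj₁ w)       = w
  α (inj₂ (w , _)) = w

  Minus : Carrier M ⊎ (Carrier M × Fin 2) → Set
  Minus (inj₁ _) = Data.Unit.⊤ where import Data.Unit
  Minus (inj₂ _) = ⊥

  Bulldoze : Model
  Bulldoze = record
    { Carrier = Carrier M ⊎ (Carrier M × Fin 2)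
    ; Dom     = λ { (inj₁ w) → Dom M w × ¬ R M w w
                  ; (inj₂ (w , _)) → Dom M w × R M w w }
    ; R       = λ x y →
          ((Minus x ⊎ Minus y) × R M (α x) (α y))
        ⊎ Σ (Carrier M) (λ w' → Σ (Fin 2) (λ m → Σ (Carrier M) (λ v' → Σ (Fin 2) (λ n →
            x ≡ inj₂ (w' , m) × y ≡ inj₂ (v' , n) × w' ≢ v' × R M w' v'))))
        ⊎ (x ≢ y × α x ≡ α y)
    ; Vp      = λ p x → Vp M p (α x)
    ; Vn      = λ i x →
          Σ (Carrier M) (λ w → Vn M i w × Dom M w × R M w w × x ≡ inj₂ (w , zero))
        ⊎ ((¬ Σ (Carrier M) (λ w → Vn M i w × Dom M w × R M w w)) ×
           Σ (Carrier M) (λ w → Vn M i w × x ≡ inj₁ w))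
    }

{-# OPTIONS --safe #-}
-- Bulldozing splits a reflexive world w into copies (w , 0) and (w , 1) which
-- see each other and otherwise have the same successors, and only (w , 0) can
-- carry a nominal; so the two copies agree on every formula none of whose
-- nominals is true at (w , 0).  It remains to see that no nominal j of the
-- root formula is true at a reflexive world of M^Θ.  Such a j has an identity
-- urfather (root nominals are quasi-urfathers, and the earliest twin exists
-- classically), so V^Θ(j) = {v(j)}.  If v(j) were reflexive, the branch would
-- contain @_a ◇ b with a, b twins of j, hence @_a j and @_b j; then (I) and
-- [Id] give @_a ¬◇ j, and [¬◇] gives @_b ¬ j, closing the branch.
module Submission where

open import Defs
open import Data.Nat using (ℕ; _<_)
open import Data.Nat.Induction using (<-wellFounded)
open import Induction.WellFounded using (Acc; acc)
open import Data.Fin using (Fin; zero; suc)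
open import Data.List using (List)
open import Data.List.Relation.Unary.Any using (here; there)
open import Data.Product using (Σ; _×_; _,_; proj₁; proj₂; swap; uncurry)
open import Data.Product.Function.NonDependent.Propositional using (_×-⇔_)
open import Data.Sum using (_⊎_; inj₁; inj₂; [_,_]′)
open import Data.Empty using (⊥-elim)
open import Data.Unit using (tt)
open import Relation.Nullary using (¬_; yes; no; ¬¬-excluded-middle)
open import Relation.Binary.PropositionalEquality using (_≡_; _≢_; refl; trans; sym)
open import Relation.Binary.Construct.Closure.ReflexiveTransitive using (ε; _◅_)
open import Function using (id)
open import Function.Bundles using (_⇔_; mk⇔; Equivalence)
open import Function.Construct.Identity using (⇔-id)
open import Function.Related.TypeIsomorphisms using (¬-cong-⇔)

Sub-trans : ∀ {φ ψ χ} → Sub φ ψ → Sub ψ χ → Sub φ χ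
Sub-trans s here     = s
Sub-trans s (neg t)  = neg (Sub-trans s t)
Sub-trans s (andl t) = andl (Sub-trans s t)
Sub-trans s (andr t) = andr (Sub-trans s t)
Sub-trans s (dia t)  = dia (Sub-trans s t)
Sub-trans s (atS t)  = atS (Sub-trans s t)

Sub-nom⇒OccF : ∀ {j ψ} → Sub (nom j) ψ → OccF j ψ
Sub-nom⇒OccF here     = onom
Sub-nom⇒OccF (neg s)  = oneg (Sub-nom⇒OccF s)
Sub-nom⇒OccF (andl s) = oandl (Sub-nom⇒OccF s)
Sub-nom⇒OccF (andr s) = oandr (Sub-nom⇒OccF s)
Sub-nom⇒OccF (dia s)  = odia (Sub-nom⇒OccF s)
Sub-nom⇒OccF (atS s)  = oat2 (Sub-nom⇒OccF s)

QSub-nom : ∀ {j φ ψ} → QSub φ ψ → Sub (nom j) φ → Sub (nom j) ψ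
QSub-nom (inj₁ φ⊑ψ)              s       = Sub-trans s φ⊑ψ
QSub-nom (inj₂ (_ , refl , χ⊑ψ)) (neg s) = Sub-trans s χ⊑ψ

¬¬-least : ∀ {p} {P : ℕ → Set p} {n} → P n →
           ¬ ¬ Σ ℕ (λ m → P m × (∀ {k} → k < m → ¬ P k))
¬¬-least {P = P} {n} pn noLeast = notP n (<-wellFounded n) pn
  where
  notP : ∀ m → Acc _<_ m → ¬ P m
  notP m (acc rec) pm = noLeast (m , pm , λ k<m → notP _ (rec k<m))

other-of-Fin2 : {m n k : Fin 2} → m ≢ n → k ≢ m → k ≡ n
other-of-Fin2 {zero}     {zero}                m≢n _   = ⊥-elim (m≢n refl)
other-of-Fin2 {zero}     {suc zero} {zero}     _   k≢m = ⊥-elim (k≢m refl)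
other-of-Fin2 {zero}     {suc zero} {suc zero} _   _   = refl
other-of-Fin2 {suc zero} {zero}     {zero}     _   _   = refl
other-of-Fin2 {suc zero} {zero}     {suc zero} _   k≢m = ⊥-elim (k≢m refl)
other-of-Fin2 {suc zero} {suc zero}            m≢n _   = ⊥-elim (m≢n refl)

module Bulldozing (M : Model) where

  open Model M using (R; Vn)

  B : Model
  B = Bulldoze M

  copy₁-unnamed : ∀ {w j} → ¬ Sat B (inj₂ (w , suc zero)) (nom j)
  copy₁-unnamed (inj₁ (_ , _ , _ , _ , ()))
  copy₁-unnamed (inj₂ (_ , _ , _ , ()))

  ◇-transfer : ∀ {w m n ψ} → R w w → m ≢ n →
               (Sat B (inj₂ (w , n)) ψ → Sat B (inj₂ (w , m)) ψ) →
               Sat B (inj₂ (w , m)) (◇ ψ) → Sat B (inj₂ (w , n)) (◇ ψ)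
  ◇-transfer _ _ _ (inj₁ u , du , inj₁ (_ , wRu) , u⊨ψ) =
    inj₁ u , du , inj₁ (inj₂ tt , wRu) , u⊨ψ
  ◇-transfer _ _ _ (inj₁ _ , _ , inj₂ (inj₁ (_ , _ , _ , _ , _ , () , _)) , _)
  ◇-transfer wRw _ _ (inj₁ _ , (_ , ¬wRw) , inj₂ (inj₂ (_ , refl)) , _) = ⊥-elim (¬wRw wRw)
  ◇-transfer _ _ _ (inj₂ _ , _ , inj₁ (inj₁ () , _) , _)
  ◇-transfer _ _ _ (inj₂ _ , _ , inj₁ (inj₂ () , _) , _)
  ◇-transfer _ _ _ (inj₂ (u , k) , du , inj₂ (inj₁ (_ , _ , _ , _ , refl , refl , w≢u , wRu)) , u⊨ψ) =
    inj₂ (u , k) , du , inj₂ (inj₁ (_ , _ , _ , _ , refl , refl , w≢u , wRu)) , u⊨ψ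
  ◇-transfer {w} {m} {n} _ m≢n back (inj₂ (.w , k) , du , inj₂ (inj₂ (wm≢wk , refl)) , wk⊨ψ)
    with other-of-Fin2 {k = k} m≢n (λ { refl → wm≢wk refl })
  ... | refl = inj₂ (w , m) , du , inj₂ (inj₂ ((λ { refl → m≢n refl }) , refl)) , back wk⊨ψ

  copies-agree : ∀ {w} → R w w → ∀ φ →
                 (∀ {j} → Sub (nom j) φ → ¬ Sat B (inj₂ (w , zero)) (nom j)) →
                 Sat B (inj₂ (w , zero)) φ ⇔ Sat B (inj₂ (w , suc zero)) φ
  copies-agree _ (prop _) _ = ⇔-id _
  copies-agree _ (nom _) unnamed = mk⇔ (λ named → ⊥-elim (unnamed here named))
                                       (λ named → ⊥-elim (copy₁-unnamed named))
  copies-agree wRw (~ φ) unnamed = ¬-cong-⇔ (copies-agree wRw φ (λ s → unnamed (neg s)))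
  copies-agree wRw (φ ∧ ψ) unnamed =
    copies-agree wRw φ (λ s → unnamed (andl s)) ×-⇔ copies-agree wRw ψ (λ s → unnamed (andr s))
  copies-agree wRw (◇ φ) unnamed =
    mk⇔ (◇-transfer {ψ = φ} wRw (λ ()) from) (◇-transfer {ψ = φ} wRw (λ ()) to)
    where open Equivalence (copies-agree wRw φ (λ s → unnamed (dia s)))
  copies-agree _ (at _ _) _ = ⇔-id _

  copy₀-named : ∀ {w j} → Sat B (inj₂ (w , zero)) (nom j) → Vn j w × R w w
  copy₀-named (inj₁ (_ , wj , _ , wRw , refl)) = wj , wRw
  copy₀-named (inj₂ (_ , _ , _ , ()))

module _ {r : LForm} where

  root-not-introduced : ∀ {h} → Branch r h → ∀ {x j} → OccL j r → ¬ Prec r h x j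
  root-not-introduced (step _ _ _ (inj₁ (r◇ _ new _ _ _))) oj (_ , here refl) = new (r , inj₁ refl , oj)
  root-not-introduced (step _ _ _ (inj₂ ())) _ (_ , here refl)
  root-not-introduced (step b _ _ _) oj (φ , there p) = root-not-introduced b oj (φ , p)

  Prec*-into-root : ∀ {h} → Branch r h → ∀ {x j} → OccL j r → Prec* r h x j → x ≡ j
  Prec*-into-root _ _  ε = refl
  Prec*-into-root b oj (x≺y ◅ y≺*j) with Prec*-into-root b oj y≺*j
  ... | refl = ⊥-elim (root-not-introduced b oj x≺y)

  root-quasi-urfather : ∀ {h j} → Branch r h → OccL j r → QU r h j
  root-quasi-urfather b oj (_ , _ , a≢c , _ , a≺*j , c≺*j) =
    a≢c (trans (Prec*-into-root b oj a≺*j) (sym (Prec*-into-root b oj c≺*j)))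

  nothing-before-i₀ : ∀ {h k} → ¬ Before r h k (i₀ r)
  nothing-before-i₀ (inj₁ (_ , _ , _ , _ , ¬occ))         = ¬occ (r , inj₁ refl , inj₁ refl)
  nothing-before-i₀ (inj₂ (inj₁ (_ , i₀≢i₀ , _)))         = i₀≢i₀ refl
  nothing-before-i₀ (inj₂ (inj₂ (_ , _ , _ , i₀≢i₀ , _))) = i₀≢i₀ refl

  before-root : ∀ {h k n} → OccL n r → Before r h k n → k ≡ i₀ r ⊎ (OccL k r × k < n)
  before-root on (inj₁ (_ , _ , _ , _ , ¬occ))            = ⊥-elim (¬occ (r , inj₁ refl , on))
  before-root _  (inj₂ (inj₁ (k≡i₀ , _)))                 = inj₁ k≡i₀
  before-root _  (inj₂ (inj₂ (ok , _ , _ , _ , k<n)))     = inj₂ (ok , k<n)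

  UrfatherCandidate : List Step → Nom → Nom → Set
  UrfatherCandidate h j k = OccB r h k × Twins r h j k × QU r h k

  root-nominal-has-identity-urfather : ∀ {h j} → Branch r h → OccL j r → ¬ ¬ Σ Nom (IsV r h j)
  root-nominal-has-identity-urfather {h} {j} b oj noV =
    ¬¬-excluded-middle λ
      { (yes i₀-candidate) → noV (earliest (λ _ → nothing-before-i₀) i₀-candidate)
      ; (no ¬i₀-candidate) → ¬¬-least {P = RootCandidate} j-candidate λ
          { (m , (om , m-candidate) , least) →
              noV (earliest (nothing-before-least ¬i₀-candidate om least) m-candidate) }
      }
    where
    RootCandidate : Nom → Set
    RootCandidate k = OccL k r × UrfatherCandidate h j k

    j-candidate : RootCandidate j
    j-candidate = oj , (r , inj₁ refl , oj) , (λ _ → id , id) , root-quasi-urfather b oj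

    nothing-before-least : ∀ {m k} → ¬ UrfatherCandidate h j (i₀ r) → OccL m r →
                           (∀ {n} → n < m → ¬ RootCandidate n) →
                           UrfatherCandidate h j k → ¬ Before r h k m
    nothing-before-least ¬i₀-candidate om least k-candidate k≺m with before-root om k≺m
    ... | inj₁ refl       = ¬i₀-candidate k-candidate
    ... | inj₂ (ok , k<m) = least k<m (ok , k-candidate)

    earliest : ∀ {m} → (∀ {k} → UrfatherCandidate h j k → ¬ Before r h k m) →
               UrfatherCandidate h j m → Σ Nom (IsV r h j)
    earliest {m} first (om , tw , qu) =
      m , (r , inj₁ refl , oj) , om , tw , qu , λ _ ok tk qk → first (ok , tk , qk)

  same-name-not-accessible : ∀ {h a b j} → ¬ Closed r h → Saturated r h →
                             InB r h (a , nom j) → InB r h (b , nom j) → ¬ InB r h (a , ◇ nom b)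
  same-name-not-accessible {h} {a} {b} {j} ¬closed (legal , _) a⊢j b⊢j a⊢◇b =
    ¬closed (b , nom j , b⊢j , b⊢¬j)
    where
    a⊢a : InB r h (a , nom a)
    a⊢a = legal _ (rRef (_ , a⊢◇b , inj₁ refl))
    j⊢a : InB r h (j , nom a)
    j⊢a = legal _ (rId a⊢a a⊢j (λ { (_ , _ , _ , ()) }))
    j⊢¬◇j : InB r h (j , ~ ◇ nom j)
    j⊢¬◇j = legal _ (rI (_ , a⊢j , inj₂ onom))
    a⊢¬◇j : InB r h (a , ~ ◇ nom j)
    a⊢¬◇j = legal _ (rId j⊢¬◇j j⊢a (λ { (_ , _ , _ , ()) }))
    b⊢¬j : InB r h (b , ~ nom j)
    b⊢¬j = legal _ (r¬◇ a⊢¬◇j a⊢◇b)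

  root-nominal-in-T : ∀ {h j} → Saturated r h → Sub (nom j) (root-body r) → TIn r h j (nom j)
  root-nominal-in-T (legal , _) sj = legal _ (rRef (r , inj₁ refl , inj₂ (Sub-nom⇒OccF sj))) , inj₁ sj

  root-nominal-irreflexive : ∀ {h j w} → Branch r h → ¬ Closed r h → Saturated r h →
                             Sub (nom j) (root-body r) →
                             Model.Vn (BranchModel r h) j w → ¬ Model.R (BranchModel r h) w w
  root-nominal-irreflexive {h} {j} {w} _ ¬closed sat sj (inj₁ (_ , _ , jw , _)) (a , c , a⊢◇c , v) =
    same-name-not-accessible ¬closed sat (named (proj₁ ac)) (named (proj₂ ac)) a⊢◇c
    where
    ac : IsV r h a w × IsV r h c w
    ac = [ id , swap ]′ v
    w⊢j : TIn r h w (nom j)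
    w⊢j = proj₁ (jw (nom j)) (root-nominal-in-T sat sj)
    named : ∀ {x} → IsV r h x w → InB r h (x , nom j)
    named (_ , _ , xw , _) = proj₁ (proj₂ (xw (nom j)) w⊢j)
  root-nominal-irreflexive b _ _ sj (inj₂ (noV , refl)) _ =
    root-nominal-has-identity-urfather b (inj₂ (Sub-nom⇒OccF sj)) noV

lemma12 : (i₀ : Nom) (φ₀ : Form) (Θ : List Step) →
          ¬ OccF i₀ φ₀ →
          Branch (i₀ , φ₀) Θ →
          ¬ Closed (i₀ , φ₀) Θ →
          Saturated (i₀ , φ₀) Θ →
          (i : Nom) → Model.Dom (BranchModel (i₀ , φ₀) Θ) i →
          Model.R (BranchModel (i₀ , φ₀) Θ) i i →
          (φ : Form) → QSub φ φ₀ →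
          Sat (Bulldoze (BranchModel (i₀ , φ₀) Θ)) (inj₂ (i , zero)) φ ⇔
          Sat (Bulldoze (BranchModel (i₀ , φ₀) Θ)) (inj₂ (i , suc zero)) φ
lemma12 i₀ φ₀ Θ _ b ¬closed sat i _ iRi φ φ⊑φ₀ =
  copies-agree iRi φ λ sj named →
    uncurry (root-nominal-irreflexive b ¬closed sat (QSub-nom φ⊑φ₀ sj)) (copy₀-named named)
  where open Bulldozing (BranchModel (i₀ , φ₀) Θ)
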